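{- For a graph $G$, $\sigma(G)=\sigma_t(G)$ if and only if $G$ is a generalized complete $k$-partite graph (for some $k\geq 1$).
   Context: For a finite simple graph $G$ with $d(v)$ the degree of $v$: $\sigma(G)=\sum_{uv\in E(G)}(d(u)-d(v))^{2}$ (sum over edges) and $\sigma_{t}(G)=\sum_{\{u,v\}\subseteq V(G)}(d(u)-d(v))^{2}$ (sum over all unordered pairs of distinct vertices). A graph $G$ is a generalized complete $k$-partite graph if $V(G)$ can be partitioned into $k$ nonempty sets $V_1,\dots,V_k$ such that each induced subgraph $G[V_i]$ is regular and, whenever $u\in V_i$, $v\in V_j$ with $i\neq j$, $uv$ is an edge of $G$. -}

module Defs where

open import Data.Nat using (ℕ; zero; suc; _+_; _*_; _≤_; ∣_-_∣; _<ᵇ_)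
open import Data.Fin using (Fin; zero; suc; toℕ; _≟_)
open import Data.Bool using (Bool; true; false; if_then_else_; _∧_)
open import Data.Product using (Σ; ∃; _×_)
open import Relation.Nullary using (¬_)
open import Relation.Nullary.Decidable using (⌊_⌋)
open import Relation.Binary.PropositionalEquality using (_≡_)

record Graph (n : ℕ) : Set where
  field
    adj    : Fin n → Fin n → Bool
    sym    : ∀ u v → adj u v ≡ adj v u
    irrefl : ∀ v → adj v v ≡ false
open Graph public

sumFin : (n : ℕ) → (Fin n → ℕ) → ℕ
sumFin zero    f = 0
sumFin (suc n) f = f zero + sumFin n (λ i → f (suc i))

indicator : Bool → ℕ
indicator b = if b then 1 else 0

degree : ∀ {n} → Graph n → Fin n → ℕ
degree {n} G v = sumFin n (λ w → indicator (adj G v w))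

sqDiff : ∀ {n} → Graph n → Fin n → Fin n → ℕ
sqDiff G u v = ∣ degree G u - degree G v ∣ * ∣ degree G u - degree G v ∣

sigma : ∀ {n} → Graph n → ℕ
sigma {n} G = sumFin n (λ u → sumFin n (λ v →
  if (toℕ u <ᵇ toℕ v) ∧ adj G u v then sqDiff G u v else 0))

sigmaT : ∀ {n} → Graph n → ℕ
sigmaT {n} G = sumFin n (λ u → sumFin n (λ v →
  if toℕ u <ᵇ toℕ v then sqDiff G u v else 0))

partDegree : ∀ {n k} → Graph n → (Fin n → Fin k) → Fin n → ℕ
partDegree {n} G part v =
  sumFin n (λ w → indicator (adj G v w ∧ ⌊ part w ≟ part v ⌋))

IsGenCompleteKPartite : ∀ {n} → Graph n → ℕ → Set
IsGenCompleteKPartite {n} G k =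
  Σ (Fin n → Fin k) λ part →
      (∀ (i : Fin k) → ∃ λ v → part v ≡ i)
    × (∀ (i : Fin k) → ∃ λ r → ∀ v → part v ≡ i → partDegree G part v ≡ r)
    × (∀ u v → ¬ (part u ≡ part v) → adj G u v ≡ true)

IsGenComplete : ∀ {n} → Graph n → Set
IsGenComplete G = ∃ λ k → (1 ≤ k) × IsGenCompleteKPartite G k

{-# OPTIONS --safe #-}
-- σ_t(G) − σ(G) is the sum of (d(u) − d(v))² over the non-adjacent pairs, so σ = σ_t exactly
-- when non-adjacent vertices have equal degrees.  If G is generalized complete multipartite,
-- non-adjacent vertices lie in a common part V_i and d(v) = d_{G[V_i]}(v) + |V \ V_i| is
-- constant on V_i.  Conversely, partition V by degree: vertices in different parts have
-- different degrees and hence are adjacent, and within a part the same identity shows that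
-- G[V_i] is regular.
module Submission where

open import Defs hiding (sym)
open import Data.Bool using (true; false; if_then_else_; _∧_; not)
open import Data.Bool.Properties using (¬-not; not-¬; T-≡)
open import Data.Fin using (Fin; zero; suc; toℕ; _<_; _≟_)
open import Data.Fin.Properties using (<-cmp; nonZeroIndex; any?; suc-injective)
open import Data.Nat using (ℕ; zero; suc; _+_; _*_; ∣_-_∣; _<ᵇ_; >-nonZero⁻¹)
  renaming (_≟_ to _≟ℕ_)
open import Data.Nat.Properties
  using (+-identityʳ; +-cancelˡ-≡; +-cancelʳ-≡; m+n≡0⇒m≡0; m+n≡0⇒n≡0; m*n≡0⇒m≡0∨n≡0;
         ∣m-n∣≡0⇒m≡n; m≡n⇒∣m-n∣≡0; <⇒<ᵇ; +-commutativeSemigroup)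
open import Algebra.Properties.CommutativeSemigroup +-commutativeSemigroup using (interchange)
open import Data.Product using (∃; _,_)
open import Data.Sum using (reduce)
open import Function.Bundles using (_⇔_; mk⇔; Equivalence)
open import Function.Properties.Equivalence using () renaming (trans to ⇔-trans)
open import Relation.Binary using (tri<; tri≈; tri>)
open import Relation.Binary.Definitions using (DecidableEquality)
open import Relation.Binary.PropositionalEquality
  using (_≡_; _≢_; refl; sym; trans; cong; cong₂; module ≡-Reasoning)
open import Relation.Nullary using (¬_; Dec; yes; no)
open import Relation.Nullary.Decidable using (⌊_⌋; decidable-stable)

open Equivalence using (to; from)

sumFin-cong : ∀ n {f g : Fin n → ℕ} → (∀ i → f i ≡ g i) → sumFin n f ≡ sumFin n g
sumFin-cong zero    f≗g = refl
sumFin-cong (suc n) f≗g = cong₂ _+_ (f≗g zero) (sumFin-cong n (λ i → f≗g (suc i)))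

sumFin-+ : ∀ n (f g : Fin n → ℕ) → sumFin n (λ i → f i + g i) ≡ sumFin n f + sumFin n g
sumFin-+ zero    f g = refl
sumFin-+ (suc n) f g = begin
  f zero + g zero + sumFin n (λ i → f (suc i) + g (suc i))
    ≡⟨ cong (f zero + g zero +_) (sumFin-+ n (λ i → f (suc i)) (λ i → g (suc i))) ⟩
  f zero + g zero + (sumFin n (λ i → f (suc i)) + sumFin n (λ i → g (suc i)))
    ≡⟨ interchange (f zero) (g zero) _ _ ⟩
  f zero + sumFin n (λ i → f (suc i)) + (g zero + sumFin n (λ i → g (suc i))) ∎
  where open ≡-Reasoning

sumFin≡0⇒≡0 : ∀ n (f : Fin n → ℕ) → sumFin n f ≡ 0 → ∀ i → f i ≡ 0
sumFin≡0⇒≡0 (suc n) f Σf≡0 zero    = m+n≡0⇒m≡0 (f zero) Σf≡0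
sumFin≡0⇒≡0 (suc n) f Σf≡0 (suc i) =
  sumFin≡0⇒≡0 n (λ j → f (suc j)) (m+n≡0⇒n≡0 (f zero) Σf≡0) i

≡0⇒sumFin≡0 : ∀ n (f : Fin n → ℕ) → (∀ i → f i ≡ 0) → sumFin n f ≡ 0
≡0⇒sumFin≡0 zero    f f≡0 = refl
≡0⇒sumFin≡0 (suc n) f f≡0 = cong₂ _+_ (f≡0 zero) (≡0⇒sumFin≡0 n (λ i → f (suc i)) (λ i → f≡0 (suc i)))

∣m-n∣*∣m-n∣≡0⇔m≡n : ∀ m n → ∣ m - n ∣ * ∣ m - n ∣ ≡ 0 ⇔ m ≡ n
∣m-n∣*∣m-n∣≡0⇔m≡n m n = mk⇔
  (λ sq≡0 → ∣m-n∣≡0⇒m≡n (reduce (m*n≡0⇒m≡0∨n≡0 ∣ m - n ∣ sq≡0)))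
  (λ m≡n → cong (λ d → d * d) (m≡n⇒∣m-n∣≡0 m≡n))

if-split : ∀ b a s → (if b then s else 0) ≡ (if b ∧ a then s else 0) + (if b ∧ not a then s else 0)
if-split false a     s = refl
if-split true  true  s = sym (+-identityʳ s)
if-split true  false s = refl

if-∧-not≡0⇔ : ∀ b a s → (if b ∧ not a then s else 0) ≡ 0 ⇔ (b ≡ true → a ≡ false → s ≡ 0)
if-∧-not≡0⇔ false a     s = mk⇔ (λ _ ()) (λ _ → refl)
if-∧-not≡0⇔ true  true  s = mk⇔ (λ _ _ ()) (λ _ → refl)
if-∧-not≡0⇔ true  false s = mk⇔ (λ s≡0 _ _ → s≡0) (λ h → h refl refl)

indicator-split : ∀ a {P : Set} (P? : Dec P) → (¬ P → a ≡ true) →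
                  indicator a ≡ indicator (a ∧ ⌊ P? ⌋) + indicator (not ⌊ P? ⌋)
indicator-split true  (yes _) _ = refl
indicator-split false (yes _) _ = refl
indicator-split true  (no _)  _ = refl
indicator-split false (no ¬p) h with () ← h ¬p

record ValuePartition {A : Set} {m : ℕ} (f : Fin m → A) : Set where
  field
    size             : ℕ
    class            : Fin m → Fin size
    class-surjective : ∀ i → ∃ λ v → class v ≡ i
    class≡⇒value≡    : ∀ u v → class u ≡ class v → f u ≡ f v
    value≡⇒class≡    : ∀ u v → f u ≡ f v → class u ≡ class v

module _ {A : Set} (_≟ᴬ_ : DecidableEquality A) where

  valuePartition : ∀ {m} (f : Fin m → A) → ValuePartition f
  valuePartition {zero} f = record
    { size = 0 ; class = λ () ; class-surjective = λ () ; class≡⇒value≡ = λ () ; value≡⇒class≡ = λ () }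
  valuePartition {suc m} f with valuePartition (λ i → f (suc i)) | any? (λ j → f (suc j) ≟ᴬ f zero)
  ... | P | yes (j , fj≡f0) = record
    { size = size ; class = class′ ; class-surjective = surjective
    ; class≡⇒value≡ = sound ; value≡⇒class≡ = complete }
    where
    open ValuePartition P
    class′ : Fin (suc m) → Fin size
    class′ zero    = class j
    class′ (suc i) = class i
    surjective : ∀ i → ∃ λ v → class′ v ≡ i
    surjective i with v , cv≡i ← class-surjective i = suc v , cv≡i
    sound : ∀ u v → class′ u ≡ class′ v → f u ≡ f v
    sound zero    zero    _ = refl
    sound zero    (suc v) e = trans (sym fj≡f0) (class≡⇒value≡ j v e)
    sound (suc u) zero    e = trans (class≡⇒value≡ u j e) fj≡f0
    sound (suc u) (suc v) e = class≡⇒value≡ u v e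
    complete : ∀ u v → f u ≡ f v → class′ u ≡ class′ v
    complete zero    zero    _ = refl
    complete zero    (suc v) e = value≡⇒class≡ j v (trans fj≡f0 e)
    complete (suc u) zero    e = value≡⇒class≡ u j (trans e (sym fj≡f0))
    complete (suc u) (suc v) e = value≡⇒class≡ u v e
  ... | P | no f0-new = record
    { size = suc size ; class = class′ ; class-surjective = surjective
    ; class≡⇒value≡ = sound ; value≡⇒class≡ = complete }
    where
    open ValuePartition P
    class′ : Fin (suc m) → Fin (suc size)
    class′ zero    = zero
    class′ (suc i) = suc (class i)
    surjective : ∀ i → ∃ λ v → class′ v ≡ i
    surjective zero = zero , refl
    surjective (suc i) with v , cv≡i ← class-surjective i = suc v , cong suc cv≡i
    sound : ∀ u v → class′ u ≡ class′ v → f u ≡ f v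
    sound zero    zero    _ = refl
    sound (suc u) (suc v) e = class≡⇒value≡ u v (suc-injective e)
    complete : ∀ u v → f u ≡ f v → class′ u ≡ class′ v
    complete zero    zero    _ = refl
    complete zero    (suc v) e with () ← f0-new (v , sym e)
    complete (suc u) zero    e with () ← f0-new (u , e)
    complete (suc u) (suc v) e = cong suc (value≡⇒class≡ u v e)

module _ {n : ℕ} (G : Graph n) where

  NonadjacentEqualDegree : Set
  NonadjacentEqualDegree = ∀ u v → adj G u v ≡ false → degree G u ≡ degree G v

  nonEdgeSigma : ℕ
  nonEdgeSigma = sumFin n (λ u → sumFin n (λ v →
    if (toℕ u <ᵇ toℕ v) ∧ not (adj G u v) then sqDiff G u v else 0))

  sigmaT≡sigma+nonEdgeSigma : sigmaT G ≡ sigma G + nonEdgeSigma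
  sigmaT≡sigma+nonEdgeSigma = trans
    (sumFin-cong n λ u → trans
      (sumFin-cong n λ v → if-split (toℕ u <ᵇ toℕ v) (adj G u v) (sqDiff G u v))
      (sumFin-+ n _ _))
    (sumFin-+ n _ _)

  sigma≡sigmaT⇔nonEdgeSigma≡0 : sigma G ≡ sigmaT G ⇔ nonEdgeSigma ≡ 0
  sigma≡sigmaT⇔nonEdgeSigma≡0 = mk⇔
    (λ σ≡σt → +-cancelˡ-≡ (sigma G) _ _
       (trans (sym sigmaT≡sigma+nonEdgeSigma) (trans (sym σ≡σt) (sym (+-identityʳ (sigma G))))))
    (λ σ̄≡0 → sym (trans sigmaT≡sigma+nonEdgeSigma
       (trans (cong (sigma G +_) σ̄≡0) (+-identityʳ (sigma G)))))

  ordered⇒nonadjacentEqualDegree :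
    (∀ u v → u < v → adj G u v ≡ false → degree G u ≡ degree G v) → NonadjacentEqualDegree
  ordered⇒nonadjacentEqualDegree h u v uv∉E with <-cmp u v
  ... | tri< u<v _ _ = h u v u<v uv∉E
  ... | tri≈ _ refl _ = refl
  ... | tri> _ _ v<u = sym (h v u v<u (trans (Graph.sym G v u) uv∉E))

  nonEdgeSigma≡0⇔nonadjacentEqualDegree : nonEdgeSigma ≡ 0 ⇔ NonadjacentEqualDegree
  nonEdgeSigma≡0⇔nonadjacentEqualDegree = mk⇔
    (λ σ̄≡0 → ordered⇒nonadjacentEqualDegree λ u v u<v uv∉E →
      to (∣m-n∣*∣m-n∣≡0⇔m≡n (degree G u) (degree G v))
        (to (if-∧-not≡0⇔ _ _ _) (sumFin≡0⇒≡0 n _ (sumFin≡0⇒≡0 n _ σ̄≡0 u) v) (to T-≡ (<⇒<ᵇ u<v)) uv∉E))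
    (λ h → ≡0⇒sumFin≡0 n _ λ u → ≡0⇒sumFin≡0 n _ λ v →
      from (if-∧-not≡0⇔ _ _ _) λ _ uv∉E →
        from (∣m-n∣*∣m-n∣≡0⇔m≡n (degree G u) (degree G v)) (h u v uv∉E))

module _ {n k : ℕ} (G : Graph n) (part : Fin n → Fin k)
         (complete : ∀ u v → part u ≢ part v → adj G u v ≡ true) where

  outsideSize : Fin k → ℕ
  outsideSize i = sumFin n (λ w → indicator (not ⌊ part w ≟ i ⌋))

  degree≡partDegree+outsideSize : ∀ v → degree G v ≡ partDegree G part v + outsideSize (part v)
  degree≡partDegree+outsideSize v = trans
    (sumFin-cong n λ w → indicator-split (adj G v w) (part w ≟ part v)
      λ pw≢pv → complete v w λ pv≡pw → pw≢pv (sym pv≡pw))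
    (sumFin-+ n _ _)

  degree≡⇔partDegree≡ : ∀ u v → part u ≡ part v →
                        degree G u ≡ degree G v ⇔ partDegree G part u ≡ partDegree G part v
  degree≡⇔partDegree≡ u v pu≡pv = mk⇔
    (λ du≡dv → +-cancelʳ-≡ _ _ _ (begin
      partDegree G part u + outsideSize (part v) ≡⟨ cong (partDegree G part u +_) (cong outsideSize (sym pu≡pv)) ⟩
      partDegree G part u + outsideSize (part u) ≡⟨ sym (degree≡partDegree+outsideSize u) ⟩
      degree G u                                 ≡⟨ du≡dv ⟩
      degree G v                                 ≡⟨ degree≡partDegree+outsideSize v ⟩
      partDegree G part v + outsideSize (part v) ∎))
    (λ pdu≡pdv → begin
      degree G u                                 ≡⟨ degree≡partDegree+outsideSize u ⟩
      partDegree G part u + outsideSize (part u) ≡⟨ cong₂ _+_ pdu≡pdv (cong outsideSize pu≡pv) ⟩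
      partDegree G part v + outsideSize (part v) ≡⟨ sym (degree≡partDegree+outsideSize v) ⟩
      degree G v                                 ∎)
    where open ≡-Reasoning

genCompleteKPartite⇒nonadjacentEqualDegree :
  ∀ {n k} (G : Graph n) → IsGenCompleteKPartite G k → NonadjacentEqualDegree G
genCompleteKPartite⇒nonadjacentEqualDegree G (part , _ , regular , complete) u v uv∉E
  with r , partDegree≡r ← regular (part v) =
  from (degree≡⇔partDegree≡ G part complete u v pu≡pv)
       (trans (partDegree≡r u pu≡pv) (sym (partDegree≡r v refl)))
  where
  pu≡pv : part u ≡ part v
  pu≡pv = decidable-stable (part u ≟ part v) λ pu≢pv → not-¬ uv∉E (complete u v pu≢pv)

nonadjacentEqualDegree⇒genComplete :
  ∀ {n} (G : Graph (suc n)) → NonadjacentEqualDegree G → IsGenComplete G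
nonadjacentEqualDegree⇒genComplete G nonadj⇒deg≡ =
  size , >-nonZero⁻¹ size {{nonZeroIndex (class zero)}} , class , class-surjective , regular , complete
  where
  open ValuePartition (valuePartition _≟ℕ_ (degree G))
  complete : ∀ u v → class u ≢ class v → adj G u v ≡ true
  complete u v cu≢cv = ¬-not λ uv∉E → cu≢cv (value≡⇒class≡ u v (nonadj⇒deg≡ u v uv∉E))
  regular : ∀ i → ∃ λ r → ∀ v → class v ≡ i → partDegree G class v ≡ r
  regular i with v₀ , cv₀≡i ← class-surjective i =
    partDegree G class v₀ , λ v cv≡i →
      let cv≡cv₀ = trans cv≡i (sym cv₀≡i)
      in to (degree≡⇔partDegree≡ G class complete v v₀ cv≡cv₀) (class≡⇒value≡ v v₀ cv≡cv₀)

proposition21 : ∀ (n : ℕ) (G : Graph (suc n)) → (sigma G ≡ sigmaT G) ⇔ IsGenComplete G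
proposition21 n G =
  ⇔-trans (sigma≡sigmaT⇔nonEdgeSigma≡0 G)
  (⇔-trans (nonEdgeSigma≡0⇔nonadjacentEqualDegree G)
           (mk⇔ (nonadjacentEqualDegree⇒genComplete G)
                (λ { (k , _ , kPartite) → genCompleteKPartite⇒nonadjacentEqualDegree G kPartite })))
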